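{- Let $q$ be a positive definite rational quadratic form in $n$ variables, let $G=G_0(\mathbb{Q}^n,q)$, let $a,b$ be vertices of $G$ and $k$ a positive integer. Then $p_G(a,b,k)=1$ if and only if $q(a-b)=k^2$.
   Context: $G(\mathbb{Q}^n,q)$ is the graph with vertex set $\mathbb{Q}^n$ in which $x,y$ are adjacent iff $q(x-y)=1$; $G_0(\mathbb{Q}^n,q)$ is its connected component containing $0$. For a graph $G$, $p_G(a,b,k)$ is the number of paths of length $k$ from $a$ to $b$, a path of length $k$ being a sequence of vertices $a=x_1,x_2,\ldots,x_{k+1}=b$ with $x_i$ adjacent to $x_{i+1}$ for each $i$. -}

module Defs where

open import Data.Nat using (ℕ; zero; suc)
open import Data.Fin using (Fin; zero; suc; fromℕ; inject₁)
open import Data.Vec using (Vec; lookup; replicate; zipWith)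
open import Data.Rational using (ℚ; 0ℚ; 1ℚ; _+_; _*_; _-_; _<_)
open import Data.Product using (Σ; ∃; _×_)
open import Relation.Binary.PropositionalEquality using (_≡_)
open import Relation.Nullary using (¬_)

Point : ℕ → Set
Point n = Vec ℚ n

origin : ∀ {n} → Point n
origin = replicate _ 0ℚ

_-ᵥ_ : ∀ {n} → Point n → Point n → Point n
x -ᵥ y = zipWith _-_ x y

sumFin : ∀ n → (Fin n → ℚ) → ℚ
sumFin zero    f = 0ℚ
sumFin (suc n) f = f zero + sumFin n (λ i → f (suc i))

-- A rational quadratic form in n variables, given by a coefficient
-- matrix A: q(x) = Σ_i Σ_j A i j * x_i * x_j  (every quadratic form arises so).
QForm : ℕ → Set
QForm n = Fin n → Fin n → ℚ

eval : ∀ {n} → QForm n → Point n → ℚ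
eval {n} A x = sumFin n (λ i → sumFin n (λ j → A i j * (lookup x i * lookup x j)))

PositiveDefinite : ∀ {n} → QForm n → Set
PositiveDefinite {n} A = ∀ (x : Point n) → ¬ (x ≡ origin) → 0ℚ < eval A x

Adj : ∀ {n} → QForm n → Point n → Point n → Set
Adj A x y = eval A (x -ᵥ y) ≡ 1ℚ

IsWalk : ∀ {n} → QForm n → (k : ℕ) → Point n → Point n → (Fin (suc k) → Point n) → Set
IsWalk A k a b w =
  (w zero ≡ a) × (w (fromℕ k) ≡ b) × (∀ (i : Fin k) → Adj A (w (inject₁ i)) (w (suc i)))

InG0 : ∀ {n} → QForm n → Point n → Set
InG0 A x = Σ ℕ λ m → Σ (Fin (suc m) → Point _) λ w → IsWalk A m origin x w

-- Paths of length k in G_0 from a to b: walks whose vertices all lie in G_0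
-- (adjacency in the induced subgraph G_0 is adjacency in G)
IsPathG0 : ∀ {n} → QForm n → (k : ℕ) → Point n → Point n → (Fin (suc k) → Point n) → Set
IsPathG0 A k a b w = IsWalk A k a b w × (∀ i → InG0 A (w i))

ExactlyOnePath : ∀ {n} → QForm n → (k : ℕ) → Point n → Point n → Set
ExactlyOnePath A k a b =
  Σ (Fin (suc k) → Point _) (λ w → IsPathG0 A k a b w) ×
  (∀ w w′ → IsPathG0 A k a b w → IsPathG0 A k a b w′ → ∀ i → w i ≡ w′ i)

-- Let q be given by A, write B(x,y) = xᵀAy and put c = (a − b)/k. For a walk
-- a = w₀, …, w_k = b of G, every step sᵢ = wᵢ − wᵢ₊₁ has q(sᵢ) = 1, so
--   Σᵢ q(sᵢ − c) = k − (B(a − b, c) + B(c, a − b)) + k q(c),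
-- which vanishes when q(a − b) = k². By positive definiteness every step of
-- every walk is then c: the straight walk a, a − c, …, b is the only path.
-- Conversely, replacing w₁ by w₀ − (w₁ − w₂) exchanges the first two steps of
-- a path and gives another path (still in G₀, as it starts at w₀), so if the
-- path is unique all its steps equal one s with q(s) = 1; then a − b = k s
-- and q(a − b) = k².
{-# OPTIONS --safe #-}
module Submission where

open import Defs
open import Data.Nat using (ℕ; _≤_; zero; suc)
open import Data.Integer using (+_)
open import Data.Rational using (ℚ; _/_; _*_)
open import Relation.Binary.PropositionalEquality using (_≡_)
open import Function.Bundles using (_⇔_)

open import Data.Product using (∃-syntax; _×_; _,_; proj₁; proj₂)
open import Data.Fin using (Fin; zero; suc; fromℕ)
open import Data.Vec using ([]; _∷_; lookup; map)
open import Data.Vec.Properties using (lookup-zipWith; lookup-map; ∷-injectiveˡ; ∷-injectiveʳ; ≡-dec)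
open import Data.Vec.Functional using (tail) renaming (_∷_ to _∷ᶠ_)
import Data.Integer as ℤ
import Data.Integer.Properties as ℤ
open import Data.Nat.Coprimality using (1-coprimeTo) renaming (sym to coprime-sym)
open import Data.Rational using (0ℚ; 1ℚ; _+_; _-_; mkℚ; 1/_) renaming (_≤_ to _≤ℚ_)
open import Data.Rational.Properties
  using (+-0-group; _≟_; normalize-coprime; /-cong; *-inverseˡ; *-assoc; *-comm;
         *-identityˡ; *-identityʳ; *-zeroˡ; *-zeroʳ; *-distribˡ-+; +-comm; +-identityʳ;
         ≤-reflexive; ≤-antisym; <⇒≤; <-irrefl; +-mono-≤; +-monoʳ-≤)
open import Data.Rational.Solver using (module +-*-Solver)
open import Algebra.Properties.Group +-0-group using (x∙y⁻¹≈ε⇒x≈y)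
open import Data.Empty using (⊥-elim)
open import Relation.Binary.PropositionalEquality
  using (refl; sym; trans; cong; cong₂; subst; subst₂; module ≡-Reasoning)
open import Relation.Nullary using (yes; no)
open import Function.Bundles using (mk⇔)

open +-*-Solver using (solve; _:+_; _:-_; _:*_; _:=_; con)
open ≡-Reasoning

-- Unlike + m / 1, this reduces: ⟪ suc m ⟫ is 1ℚ + ⟪ m ⟫ by definition.
⟪_⟫ : ℕ → ℚ
⟪ zero ⟫  = 0ℚ
⟪ suc m ⟫ = 1ℚ + ⟪ m ⟫

+m/1≡mkℚ : ∀ m → + m / 1 ≡ mkℚ (+ m) 0 (coprime-sym (1-coprimeTo m))
+m/1≡mkℚ m = normalize-coprime _

⟪⟫≡/1 : ∀ m → ⟪ m ⟫ ≡ + m / 1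
⟪⟫≡/1 zero    = refl
⟪⟫≡/1 (suc m) = trans (cong (_+_ 1ℚ) (trans (⟪⟫≡/1 m) (+m/1≡mkℚ m)))
                      (/-cong (cong (ℤ._+_ (+ 1)) (ℤ.*-identityʳ (+ m))) refl)

⟪suc⟫-invertible : ∀ k → ∃[ r ] r * ⟪ suc k ⟫ ≡ 1ℚ
⟪suc⟫-invertible k =
  1/ K , trans (cong (1/ K *_) (trans (⟪⟫≡/1 (suc k)) (+m/1≡mkℚ (suc k)))) (*-inverseˡ K)
  where
    K : ℚ
    K = mkℚ (+ suc k) 0 (coprime-sym (1-coprimeTo (suc k)))

nonNeg+nonNeg≡0 : ∀ {p q} → 0ℚ ≤ℚ p → 0ℚ ≤ℚ q → p + q ≡ 0ℚ → p ≡ 0ℚ × q ≡ 0ℚ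
nonNeg+nonNeg≡0 {p} {q} 0≤p 0≤q p+q≡0 =
  left 0≤p 0≤q p+q≡0 , left 0≤q 0≤p (trans (+-comm q p) p+q≡0)
  where
    left : ∀ {p q} → 0ℚ ≤ℚ p → 0ℚ ≤ℚ q → p + q ≡ 0ℚ → p ≡ 0ℚ
    left {p} 0≤p 0≤q p+q≡0 =
      ≤-antisym (subst₂ _≤ℚ_ (+-identityʳ p) p+q≡0 (+-monoʳ-≤ p 0≤q)) 0≤p

[p-q]+[r-s]≡[p+r]-[q+s] : ∀ p q r s → (p - q) + (r - s) ≡ (p + r) - (q + s)
[p-q]+[r-s]≡[p+r]-[q+s] = solve 4 (λ p q r s → (p :- q) :+ (r :- s) := (p :+ r) :- (q :+ s)) refl

sumFin-cong : ∀ m {f g : Fin m → ℚ} → (∀ i → f i ≡ g i) → sumFin m f ≡ sumFin m g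
sumFin-cong zero    f≗g = refl
sumFin-cong (suc m) f≗g = cong₂ _+_ (f≗g zero) (sumFin-cong m (λ i → f≗g (suc i)))

sumFin-sub : ∀ m (f g : Fin m → ℚ) → sumFin m (λ i → f i - g i) ≡ sumFin m f - sumFin m g
sumFin-sub zero    f g = refl
sumFin-sub (suc m) f g =
  trans (cong (_+_ (f zero - g zero)) (sumFin-sub m (λ i → f (suc i)) (λ i → g (suc i))))
        ([p-q]+[r-s]≡[p+r]-[q+s] (f zero) (g zero) _ _)

sumFin-scale : ∀ m r (f : Fin m → ℚ) → sumFin m (λ i → r * f i) ≡ r * sumFin m f
sumFin-scale zero    r f = sym (*-zeroʳ r)
sumFin-scale (suc m) r f =
  trans (cong (_+_ (r * f zero)) (sumFin-scale m r (λ i → f (suc i))))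
        (sym (*-distribˡ-+ r (f zero) _))

sum² : ∀ {n} → (Fin n → Fin n → ℚ) → ℚ
sum² {n} f = sumFin n (λ i → sumFin n (f i))

sum²-cong : ∀ {n} {f g : Fin n → Fin n → ℚ} → (∀ i j → f i j ≡ g i j) → sum² f ≡ sum² g
sum²-cong {n} f≗g = sumFin-cong n (λ i → sumFin-cong n (f≗g i))

sum²-sub : ∀ {n} (f g : Fin n → Fin n → ℚ) → sum² (λ i j → f i j - g i j) ≡ sum² f - sum² g
sum²-sub {n} f g = trans (sumFin-cong n (λ i → sumFin-sub n (f i) (g i))) (sumFin-sub n _ _)

sum²-scale : ∀ {n} r (f : Fin n → Fin n → ℚ) → sum² (λ i j → r * f i j) ≡ r * sum² f
sum²-scale {n} r f = trans (sumFin-cong n (λ i → sumFin-scale n r (f i))) (sumFin-scale n r _)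

_·ᵥ_ : ∀ {n} → ℚ → Point n → Point n
r ·ᵥ x = map (r *_) x

x-ᵥ[x-ᵥy]≡y : ∀ {n} (x y : Point n) → x -ᵥ (x -ᵥ y) ≡ y
x-ᵥ[x-ᵥy]≡y []      []      = refl
x-ᵥ[x-ᵥy]≡y (p ∷ x) (q ∷ y) = cong₂ _∷_ (p-[p-q]≡q p q) (x-ᵥ[x-ᵥy]≡y x y)
  where
    p-[p-q]≡q : ∀ p q → p - (p - q) ≡ q
    p-[p-q]≡q = solve 2 (λ p q → p :- (p :- q) := q) refl

[x-ᵥ[y-ᵥz]]-ᵥz≡x-ᵥy : ∀ {n} (x y z : Point n) → (x -ᵥ (y -ᵥ z)) -ᵥ z ≡ x -ᵥ y
[x-ᵥ[y-ᵥz]]-ᵥz≡x-ᵥy []      []      []      = refl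
[x-ᵥ[y-ᵥz]]-ᵥz≡x-ᵥy (p ∷ x) (q ∷ y) (r ∷ z) =
  cong₂ _∷_ ([p-[q-r]]-r≡p-q p q r) ([x-ᵥ[y-ᵥz]]-ᵥz≡x-ᵥy x y z)
  where
    [p-[q-r]]-r≡p-q : ∀ p q r → (p - (q - r)) - r ≡ p - q
    [p-[q-r]]-r≡p-q = solve 3 (λ p q r → (p :- (q :- r)) :- r := p :- q) refl

x-ᵥ0·ᵥy≡x : ∀ {n} (x y : Point n) → x -ᵥ (0ℚ ·ᵥ y) ≡ x
x-ᵥ0·ᵥy≡x []      []      = refl
x-ᵥ0·ᵥy≡x (p ∷ x) (q ∷ y) = cong₂ _∷_ (p-0q≡p p q) (x-ᵥ0·ᵥy≡x x y)
  where
    p-0q≡p : ∀ p q → p - 0ℚ * q ≡ p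
    p-0q≡p = solve 2 (λ p q → p :- con 0ℚ :* q := p) refl

[x-ᵥy]-ᵥr·ᵥy≡x-ᵥ[1+r]·ᵥy : ∀ {n} (x y : Point n) r → (x -ᵥ y) -ᵥ (r ·ᵥ y) ≡ x -ᵥ ((1ℚ + r) ·ᵥ y)
[x-ᵥy]-ᵥr·ᵥy≡x-ᵥ[1+r]·ᵥy []      []      r = refl
[x-ᵥy]-ᵥr·ᵥy≡x-ᵥ[1+r]·ᵥy (p ∷ x) (q ∷ y) r =
  cong₂ _∷_ ([p-q]-rq≡p-[1+r]q p q r) ([x-ᵥy]-ᵥr·ᵥy≡x-ᵥ[1+r]·ᵥy x y r)
  where
    [p-q]-rq≡p-[1+r]q : ∀ p q r → (p - q) - r * q ≡ p - (1ℚ + r) * q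
    [p-q]-rq≡p-[1+r]q = solve 3 (λ p q r → (p :- q) :- r :* q := p :- (con 1ℚ :+ r) :* q) refl

·ᵥ-inverse : ∀ {n} r s → r * s ≡ 1ℚ → (x : Point n) → r ·ᵥ (s ·ᵥ x) ≡ x
·ᵥ-inverse r s rs≡1 []      = refl
·ᵥ-inverse r s rs≡1 (p ∷ x) =
  cong₂ _∷_ (trans (sym (*-assoc r s p)) (trans (cong (_* p) rs≡1) (*-identityˡ p)))
            (·ᵥ-inverse r s rs≡1 x)

origin≡0·ᵥorigin : ∀ {n} → origin {n} ≡ 0ℚ ·ᵥ origin
origin≡0·ᵥorigin {zero}  = refl
origin≡0·ᵥorigin {suc n} = cong (0ℚ ∷_) origin≡0·ᵥorigin

x-ᵥy≡origin⇒x≡y : ∀ {n} (x y : Point n) → x -ᵥ y ≡ origin → x ≡ y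
x-ᵥy≡origin⇒x≡y []      []      _ = refl
x-ᵥy≡origin⇒x≡y (p ∷ x) (q ∷ y) e =
  cong₂ _∷_ (x∙y⁻¹≈ε⇒x≈y p q (∷-injectiveˡ e)) (x-ᵥy≡origin⇒x≡y x y (∷-injectiveʳ e))

snoc : ∀ {a} {X : Set a} {m} → (Fin (suc m) → X) → X → Fin (suc (suc m)) → X
snoc {m = zero}  w y = w zero ∷ᶠ λ _ → y
snoc {m = suc m} w y = w zero ∷ᶠ snoc (tail w) y

line : ∀ {n} → Point n → Point n → (m : ℕ) → Fin (suc m) → Point n
line x c zero    = λ _ → x
line x c (suc m) = x ∷ᶠ line (x -ᵥ c) c m

line-last : ∀ {n} (x c : Point n) m → line x c m (fromℕ m) ≡ x -ᵥ (⟪ m ⟫ ·ᵥ c)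
line-last x c zero    = sym (x-ᵥ0·ᵥy≡x x c)
line-last x c (suc m) = trans (line-last (x -ᵥ c) c m) ([x-ᵥy]-ᵥr·ᵥy≡x-ᵥ[1+r]·ᵥy x c ⟪ m ⟫)

line-reaches : ∀ {n} (x b : Point n) m r → r * ⟪ m ⟫ ≡ 1ℚ → line x (r ·ᵥ (x -ᵥ b)) m (fromℕ m) ≡ b
line-reaches x b m r rM≡1 = begin
  line x (r ·ᵥ (x -ᵥ b)) m (fromℕ m)    ≡⟨ line-last x (r ·ᵥ (x -ᵥ b)) m ⟩
  x -ᵥ (⟪ m ⟫ ·ᵥ (r ·ᵥ (x -ᵥ b)))       ≡⟨ cong (x -ᵥ_) (·ᵥ-inverse ⟪ m ⟫ r Mr≡1 (x -ᵥ b)) ⟩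
  x -ᵥ (x -ᵥ b)                         ≡⟨ x-ᵥ[x-ᵥy]≡y x b ⟩
  b                                     ∎
  where
    Mr≡1 : ⟪ m ⟫ * r ≡ 1ℚ
    Mr≡1 = trans (*-comm ⟪ m ⟫ r) rM≡1

module _ {n : ℕ} (A : QForm n) where

  summand : Point n → Point n → Fin n → Fin n → ℚ
  summand x y i j = A i j * (lookup x i * lookup y j)

  bilinear : Point n → Point n → ℚ
  bilinear x y = sum² (summand x y)

  bilinear-subˡ : ∀ x y z → bilinear (x -ᵥ y) z ≡ bilinear x z - bilinear y z
  bilinear-subˡ x y z = trans
    (sum²-cong λ i j → trans (cong (λ u → A i j * (u * lookup z j)) (lookup-zipWith _-_ i x y))
                             (distrib (A i j) (lookup x i) (lookup y i) (lookup z j)))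
    (sum²-sub (summand x z) (summand y z))
    where
      distrib : ∀ a p q r → a * ((p - q) * r) ≡ a * (p * r) - a * (q * r)
      distrib = solve 4 (λ a p q r → a :* ((p :- q) :* r) := a :* (p :* r) :- a :* (q :* r)) refl

  bilinear-subʳ : ∀ x y z → bilinear z (x -ᵥ y) ≡ bilinear z x - bilinear z y
  bilinear-subʳ x y z = trans
    (sum²-cong λ i j → trans (cong (λ u → A i j * (lookup z i * u)) (lookup-zipWith _-_ j x y))
                             (distrib (A i j) (lookup z i) (lookup x j) (lookup y j)))
    (sum²-sub (summand z x) (summand z y))
    where
      distrib : ∀ a p q r → a * (p * (q - r)) ≡ a * (p * q) - a * (p * r)
      distrib = solve 4 (λ a p q r → a :* (p :* (q :- r)) := a :* (p :* q) :- a :* (p :* r)) refl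

  bilinear-scaleˡ : ∀ r x y → bilinear (r ·ᵥ x) y ≡ r * bilinear x y
  bilinear-scaleˡ r x y = trans
    (sum²-cong λ i j → trans (cong (λ u → A i j * (u * lookup y j)) (lookup-map i (r *_) x))
                             (commute r (A i j) (lookup x i) (lookup y j)))
    (sum²-scale r (summand x y))
    where
      commute : ∀ r a p q → a * ((r * p) * q) ≡ r * (a * (p * q))
      commute = solve 4 (λ r a p q → a :* ((r :* p) :* q) := r :* (a :* (p :* q))) refl

  bilinear-scaleʳ : ∀ r x y → bilinear x (r ·ᵥ y) ≡ r * bilinear x y
  bilinear-scaleʳ r x y = trans
    (sum²-cong λ i j → trans (cong (λ u → A i j * (lookup x i * u)) (lookup-map j (r *_) y))
                             (commute r (A i j) (lookup x i) (lookup y j)))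
    (sum²-scale r (summand x y))
    where
      commute : ∀ r a p q → a * (p * (r * q)) ≡ r * (a * (p * q))
      commute = solve 4 (λ r a p q → a :* (p :* (r :* q)) := r :* (a :* (p :* q))) refl

  polar : Point n → Point n → ℚ
  polar x y = bilinear x y + bilinear y x

  polar-subˡ : ∀ x y z → polar (x -ᵥ y) z ≡ polar x z - polar y z
  polar-subˡ x y z =
    trans (cong₂ _+_ (bilinear-subˡ x y z) (bilinear-subʳ x y z))
          ([p-q]+[r-s]≡[p+r]-[q+s] (bilinear x z) (bilinear y z) (bilinear z x) (bilinear z y))

  polar-scaleʳ : ∀ r x y → polar x (r ·ᵥ y) ≡ r * polar x y
  polar-scaleʳ r x y = trans (cong₂ _+_ (bilinear-scaleʳ r x y) (bilinear-scaleˡ r y x))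
                             (sym (*-distribˡ-+ r _ _))

  polar-chain : ∀ x y z c → polar (x -ᵥ z) c ≡ polar (x -ᵥ y) c + polar (y -ᵥ z) c
  polar-chain x y z c = begin
    polar (x -ᵥ z) c
      ≡⟨ polar-subˡ x z c ⟩
    polar x c - polar z c
      ≡⟨ telescope (polar x c) (polar y c) (polar z c) ⟩
    (polar x c - polar y c) + (polar y c - polar z c)
      ≡⟨ sym (cong₂ _+_ (polar-subˡ x y c) (polar-subˡ y z c)) ⟩
    polar (x -ᵥ y) c + polar (y -ᵥ z) c
      ∎
    where
      telescope : ∀ p q r → p - r ≡ (p - q) + (q - r)
      telescope = solve 3 (λ p q r → p :- r := (p :- q) :+ (q :- r)) refl

  eval-sub : ∀ x y → eval A (x -ᵥ y) ≡ eval A x - polar x y + eval A y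
  eval-sub x y = begin
    eval A (x -ᵥ y)
      ≡⟨ bilinear-subˡ x y (x -ᵥ y) ⟩
    bilinear x (x -ᵥ y) - bilinear y (x -ᵥ y)
      ≡⟨ cong₂ _-_ (bilinear-subʳ x y x) (bilinear-subʳ x y y) ⟩
    (eval A x - bilinear x y) - (bilinear y x - eval A y)
      ≡⟨ regroup (eval A x) (bilinear x y) (bilinear y x) (eval A y) ⟩
    eval A x - polar x y + eval A y
      ∎
    where
      regroup : ∀ a b c d → (a - b) - (c - d) ≡ a - (b + c) + d
      regroup = solve 4 (λ a b c d → (a :- b) :- (c :- d) := a :- (b :+ c) :+ d) refl

  eval-scale : ∀ r x → eval A (r ·ᵥ x) ≡ r * r * eval A x
  eval-scale r x = begin
    eval A (r ·ᵥ x)              ≡⟨ bilinear-scaleˡ r x (r ·ᵥ x) ⟩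
    r * bilinear x (r ·ᵥ x)      ≡⟨ cong (r *_) (bilinear-scaleʳ r x x) ⟩
    r * (r * eval A x)           ≡⟨ sym (*-assoc r r _) ⟩
    r * r * eval A x             ∎

  eval-origin : eval A origin ≡ 0ℚ
  eval-origin = trans (cong (eval A) origin≡0·ᵥorigin)
                      (trans (eval-scale 0ℚ origin) (*-zeroˡ (eval A origin)))

  adj-from-step : ∀ {x y d} → x -ᵥ y ≡ d → eval A d ≡ 1ℚ → Adj A x y
  adj-from-step {d = d} x-ᵥy≡d q[d]≡1 = subst (λ e → eval A e ≡ 1ℚ) (sym x-ᵥy≡d) q[d]≡1

  walk-first : ∀ {m x b w} → IsWalk A (suc m) x b w → Adj A x (w (suc zero))
  walk-first (refl , _ , adj) = adj zero

  walk-tail : ∀ {m x b w} → IsWalk A (suc m) x b w → IsWalk A m (w (suc zero)) b (tail w)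
  walk-tail (_ , end , adj) = refl , end , λ i → adj (suc i)

  walk-cons : ∀ {m x y b w} → Adj A x y → IsWalk A m y b w → IsWalk A (suc m) x b (x ∷ᶠ w)
  walk-cons xy (refl , end , adj) = refl , end , λ { zero → xy ; (suc i) → adj i }

  walk-snoc : ∀ {m x y z w} → IsWalk A m x y w → Adj A y z → IsWalk A (suc m) x z (snoc w z)
  walk-snoc {zero}  (refl , refl , _) yz = refl , refl , λ { zero → yz }
  walk-snoc {suc m} {w = w} W@(refl , _ , _) yz =
    walk-cons (walk-first {w = w} W) (walk-snoc (walk-tail {w = w} W) yz)

  InG0-step : ∀ {x y} → InG0 A x → Adj A x y → InG0 A y
  InG0-step (m , w , W) xy = suc m , snoc w _ , walk-snoc W xy

  walk⇒pathG0 : ∀ {m x b w} → InG0 A x → IsWalk A m x b w → IsPathG0 A m x b w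
  walk⇒pathG0 x∈G₀ W = W , onG₀ x∈G₀ W
    where
      onG₀ : ∀ {m x b w} → InG0 A x → IsWalk A m x b w → ∀ i → InG0 A (w i)
      onG₀ x∈G₀ (refl , _) zero = x∈G₀
      onG₀ {suc m} {w = w} x∈G₀ W (suc i) =
        onG₀ (InG0-step x∈G₀ (walk-first {w = w} W)) (walk-tail {w = w} W) i

  line-isWalk : ∀ c → eval A c ≡ 1ℚ → ∀ m x → IsWalk A m x (line x c m (fromℕ m)) (line x c m)
  line-isWalk c q[c]≡1 zero    x = refl , refl , λ ()
  line-isWalk c q[c]≡1 (suc m) x =
    walk-cons (adj-from-step (x-ᵥ[x-ᵥy]≡y x c) q[c]≡1) (line-isWalk c q[c]≡1 m (x -ᵥ c))

  -- Along a walk from x to b of length m this is Σᵢ q((wᵢ − wᵢ₊₁) − c), see energy-step.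
  energy : Point n → Point n → Point n → ℕ → ℚ
  energy c x b m = ⟪ m ⟫ - polar (x -ᵥ b) c + ⟪ m ⟫ * eval A c

  energy-refl : ∀ c x → energy c x x 0 ≡ 0ℚ
  energy-refl c x = trans (cong (λ s → 0ℚ - s + 0ℚ * eval A c) (polar-subˡ x x c))
                          (cancel (polar x c) (eval A c))
    where
      cancel : ∀ p q → 0ℚ - (p - p) + 0ℚ * q ≡ 0ℚ
      cancel = solve 2 (λ p q → con 0ℚ :- (p :- p) :+ con 0ℚ :* q := con 0ℚ) refl

  energy-step : ∀ c x y b m → Adj A x y →
                energy c x b (suc m) ≡ eval A ((x -ᵥ y) -ᵥ c) + energy c y b m
  energy-step c x y b m xy = begin
    (1ℚ + M) - polar (x -ᵥ b) c + (1ℚ + M) * Q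
      ≡⟨ cong (λ s → (1ℚ + M) - s + (1ℚ + M) * Q) (polar-chain x y b c) ⟩
    (1ℚ + M) - (polar (x -ᵥ y) c + polar (y -ᵥ b) c) + (1ℚ + M) * Q
      ≡⟨ regroup M Q (polar (x -ᵥ y) c) (polar (y -ᵥ b) c) ⟩
    (1ℚ - polar (x -ᵥ y) c + Q) + energy c y b m
      ≡⟨ cong (λ e → (e - polar (x -ᵥ y) c + Q) + energy c y b m) (sym xy) ⟩
    (eval A (x -ᵥ y) - polar (x -ᵥ y) c + Q) + energy c y b m
      ≡⟨ cong (_+ energy c y b m) (sym (eval-sub (x -ᵥ y) c)) ⟩
    eval A ((x -ᵥ y) -ᵥ c) + energy c y b m
      ∎
    where
      M Q : ℚ
      M = ⟪ m ⟫
      Q = eval A c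
      regroup : ∀ M Q s t → (1ℚ + M) - (s + t) + (1ℚ + M) * Q ≡ (1ℚ - s + Q) + (M - t + M * Q)
      regroup = solve 4 (λ M Q s t → (con 1ℚ :+ M) :- (s :+ t) :+ (con 1ℚ :+ M) :* Q
                                   := (con 1ℚ :- s :+ Q) :+ (M :- t :+ M :* Q)) refl

  eval-shrink : ∀ r M t → r * M ≡ 1ℚ → eval A t ≡ M * M → eval A (r ·ᵥ t) ≡ 1ℚ
  eval-shrink r M t rM≡1 q[t]≡M² = begin
    eval A (r ·ᵥ t)    ≡⟨ eval-scale r t ⟩
    r * r * eval A t   ≡⟨ cong (r * r *_) q[t]≡M² ⟩
    r * r * (M * M)    ≡⟨ solve 2 (λ r M → r :* r :* (M :* M) := (r :* M) :* (r :* M)) refl r M ⟩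
    (r * M) * (r * M)  ≡⟨ cong₂ _*_ rM≡1 rM≡1 ⟩
    1ℚ                 ∎

  energy-straight : ∀ x b m r → r * ⟪ m ⟫ ≡ 1ℚ → eval A (x -ᵥ b) ≡ ⟪ m ⟫ * ⟪ m ⟫ →
                    energy (r ·ᵥ (x -ᵥ b)) x b m ≡ 0ℚ
  energy-straight x b m r rM≡1 q[t]≡M² = begin
    M - polar t c + M * eval A c             ≡⟨ cong₂ (λ p e → M - p + M * e) (polar-scaleʳ r t t)
                                                       (eval-shrink r M t rM≡1 q[t]≡M²) ⟩
    M - r * (eval A t + eval A t) + M * 1ℚ   ≡⟨ cong (λ e → M - r * (e + e) + M * 1ℚ) q[t]≡M² ⟩
    M - r * (M * M + M * M) + M * 1ℚ         ≡⟨ regroup r M ⟩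
    M - (r * M) * M - (r * M) * M + M        ≡⟨ cong (λ u → M - u * M - u * M + M) rM≡1 ⟩
    M - 1ℚ * M - 1ℚ * M + M                  ≡⟨ cancel M ⟩
    0ℚ                                      ∎
    where
      M : ℚ
      M = ⟪ m ⟫
      t c : Point n
      t = x -ᵥ b
      c = r ·ᵥ t
      regroup : ∀ r M → M - r * (M * M + M * M) + M * 1ℚ ≡ M - (r * M) * M - (r * M) * M + M
      regroup = solve 2 (λ r M → M :- r :* (M :* M :+ M :* M) :+ M :* con 1ℚ
                                 := M :- (r :* M) :* M :- (r :* M) :* M :+ M) refl
      cancel : ∀ M → M - 1ℚ * M - 1ℚ * M + M ≡ 0ℚ
      cancel = solve 1 (λ M → M :- con 1ℚ :* M :- con 1ℚ :* M :+ M := con 0ℚ) refl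

  AtMostOnePath : ℕ → Point n → Point n → Set
  AtMostOnePath m x b = ∀ w w′ → IsPathG0 A m x b w → IsPathG0 A m x b w′ → ∀ i → w i ≡ w′ i

  atMostOnePath-tail : ∀ {m x y b} → InG0 A x → Adj A x y →
                       AtMostOnePath (suc m) x b → AtMostOnePath m y b
  atMostOnePath-tail {x = x} x∈G₀ xy unique w w′ (W , _) (W′ , _) i =
    unique (x ∷ᶠ w) (x ∷ᶠ w′) (walk⇒pathG0 x∈G₀ (walk-cons xy W))
                              (walk⇒pathG0 x∈G₀ (walk-cons xy W′)) (suc i)

  atMostOnePath⇒equal-steps : ∀ {m x b w} → IsPathG0 A (suc (suc m)) x b w →
                              AtMostOnePath (suc (suc m)) x b →
                              w (suc zero) -ᵥ w (suc (suc zero)) ≡ x -ᵥ w (suc zero)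
  atMostOnePath⇒equal-steps {m} {b = b} {w} (W@(refl , _) , onG₀) unique = begin
    w₁ -ᵥ w₂          ≡⟨ sym (x-ᵥ[x-ᵥy]≡y x (w₁ -ᵥ w₂)) ⟩
    x -ᵥ v            ≡⟨ cong (x -ᵥ_) (unique w′ w (walk⇒pathG0 (onG₀ zero) W′) (W , onG₀) (suc zero)) ⟩
    x -ᵥ w₁           ∎
    where
      x w₁ w₂ v : Point n
      x  = w zero
      w₁ = w (suc zero)
      w₂ = w (suc (suc zero))
      -- exchanging the first two steps of w gives a path through v
      v  = x -ᵥ (w₁ -ᵥ w₂)
      w′ : Fin (suc (suc (suc m))) → Point n
      w′ = x ∷ᶠ (v ∷ᶠ tail (tail w))
      W′ : IsWalk A (suc (suc m)) x b w′
      W′ = walk-cons (adj-from-step (x-ᵥ[x-ᵥy]≡y x (w₁ -ᵥ w₂))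
                                    (walk-first {w = tail w} (walk-tail {w = w} W)))
             (walk-cons (adj-from-step ([x-ᵥ[y-ᵥz]]-ᵥz≡x-ᵥy x w₁ w₂) (walk-first {w = w} W))
                        (walk-tail {w = tail w} (walk-tail {w = w} W)))

  atMostOnePath⇒line : ∀ {m x b w} → IsPathG0 A (suc m) x b w → AtMostOnePath (suc m) x b →
                       ∀ i → w i ≡ line x (x -ᵥ w (suc zero)) (suc m) i
  atMostOnePath⇒line ((refl , _) , _) _ zero = refl
  atMostOnePath⇒line {zero} {w = w} ((refl , _) , _) _ (suc zero) =
    sym (x-ᵥ[x-ᵥy]≡y (w zero) (w (suc zero)))
  atMostOnePath⇒line {suc m} {w = w} P@(W@(refl , _) , onG₀) unique (suc i) = begin
    w (suc i)                                     ≡⟨ atMostOnePath⇒line tail-path tail-unique i ⟩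
    line w₁ (w₁ -ᵥ w (suc (suc zero))) (suc m) i  ≡⟨ cong₂ (λ y s → line y s (suc m) i)
                                                           (sym (x-ᵥ[x-ᵥy]≡y (w zero) w₁))
                                                           (atMostOnePath⇒equal-steps {w = w} P unique) ⟩
    line (w zero -ᵥ s) s (suc m) i                ∎
    where
      w₁ s : Point n
      w₁ = w (suc zero)
      s  = w zero -ᵥ w₁
      tail-path : IsPathG0 A (suc m) w₁ _ (tail w)
      tail-path = walk-tail {w = w} W , λ j → onG₀ (suc j)
      tail-unique : AtMostOnePath (suc m) w₁ _
      tail-unique = atMostOnePath-tail (onG₀ zero) (walk-first {w = w} W) unique

  exactlyOnePath⇒eval≡² : ∀ {m a b} → ExactlyOnePath A (suc m) a b →
                          eval A (a -ᵥ b) ≡ ⟪ suc m ⟫ * ⟪ suc m ⟫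
  exactlyOnePath⇒eval≡² {m} {a} {b} ((w , P@(W , _)) , unique) = begin
    eval A (a -ᵥ b)                  ≡⟨ cong (λ y → eval A (a -ᵥ y)) b≡a-ᵥK·ᵥs ⟩
    eval A (a -ᵥ (a -ᵥ (K ·ᵥ s)))    ≡⟨ cong (eval A) (x-ᵥ[x-ᵥy]≡y a (K ·ᵥ s)) ⟩
    eval A (K ·ᵥ s)                  ≡⟨ eval-scale K s ⟩
    K * K * eval A s                 ≡⟨ cong (K * K *_) (walk-first {w = w} W) ⟩
    K * K * 1ℚ                       ≡⟨ *-identityʳ (K * K) ⟩
    K * K                            ∎
    where
      K : ℚ
      K = ⟪ suc m ⟫
      s : Point n
      s = a -ᵥ w (suc zero)
      b≡a-ᵥK·ᵥs : b ≡ a -ᵥ (K ·ᵥ s)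
      b≡a-ᵥK·ᵥs = begin
        b                                  ≡⟨ sym (proj₁ (proj₂ W)) ⟩
        w (fromℕ (suc m))                  ≡⟨ atMostOnePath⇒line P unique (fromℕ (suc m)) ⟩
        line a s (suc m) (fromℕ (suc m))   ≡⟨ line-last a s (suc m) ⟩
        a -ᵥ (K ·ᵥ s)                      ∎

  module _ (pd : PositiveDefinite A) where

    eval-nonNeg : ∀ x → 0ℚ ≤ℚ eval A x
    eval-nonNeg x with ≡-dec _≟_ x origin
    ... | yes refl = ≤-reflexive (sym eval-origin)
    ... | no  x≢0  = <⇒≤ (pd x x≢0)

    eval≡0⇒origin : ∀ x → eval A x ≡ 0ℚ → x ≡ origin
    eval≡0⇒origin x q≡0 with ≡-dec _≟_ x origin
    ... | yes x≡0 = x≡0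
    ... | no  x≢0 = ⊥-elim (<-irrefl (sym q≡0) (pd x x≢0))

    energy-nonNeg : ∀ c {m x b w} → IsWalk A m x b w → 0ℚ ≤ℚ energy c x b m
    energy-nonNeg c {zero} {w = w} (refl , refl , _) = ≤-reflexive (sym (energy-refl c (w zero)))
    energy-nonNeg c {suc m} {x} {b} {w} W =
      subst (0ℚ ≤ℚ_) (sym (energy-step c x (w (suc zero)) b m (walk-first {w = w} W)))
            (+-mono-≤ (eval-nonNeg ((x -ᵥ w (suc zero)) -ᵥ c))
                      (energy-nonNeg c {w = tail w} (walk-tail {w = w} W)))

    zero-energy⇒line : ∀ c {m x b w} → IsWalk A m x b w → energy c x b m ≡ 0ℚ →
                       ∀ i → w i ≡ line x c m i
    zero-energy⇒line c {zero}  (refl , _) _ zero = refl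
    zero-energy⇒line c {suc m} (refl , _) _ zero = refl
    zero-energy⇒line c {suc m} {x} {b} {w} W E≡0 (suc i) =
      trans (zero-energy⇒line c {w = tail w} (walk-tail {w = w} W) (proj₂ split) i)
            (cong (λ y → line y c m i) w₁≡x-ᵥc)
      where
        split : eval A ((x -ᵥ w (suc zero)) -ᵥ c) ≡ 0ℚ × energy c (w (suc zero)) b m ≡ 0ℚ
        split = nonNeg+nonNeg≡0 (eval-nonNeg ((x -ᵥ w (suc zero)) -ᵥ c))
                                (energy-nonNeg c {w = tail w} (walk-tail {w = w} W))
                                (trans (sym (energy-step c x (w (suc zero)) b m (walk-first {w = w} W))) E≡0)
        w₁≡x-ᵥc : w (suc zero) ≡ x -ᵥ c
        w₁≡x-ᵥc = trans (sym (x-ᵥ[x-ᵥy]≡y x (w (suc zero))))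
                        (cong (x -ᵥ_) (x-ᵥy≡origin⇒x≡y _ c (eval≡0⇒origin _ (proj₁ split))))

    eval≡²⇒exactlyOnePath : ∀ {m a b} → InG0 A a → ∃[ r ] r * ⟪ m ⟫ ≡ 1ℚ →
                            eval A (a -ᵥ b) ≡ ⟪ m ⟫ * ⟪ m ⟫ → ExactlyOnePath A m a b
    eval≡²⇒exactlyOnePath {m} {a} {b} a∈G₀ (r , rM≡1) q≡M² =
      (line a c m , walk⇒pathG0 a∈G₀ straight-walk) , λ w w′ (W , _) (W′ , _) i →
        trans (zero-energy⇒line c W E≡0 i) (sym (zero-energy⇒line c W′ E≡0 i))
      where
        c : Point n
        c = r ·ᵥ (a -ᵥ b)
        straight-walk : IsWalk A m a b (line a c m)
        straight-walk = subst (λ e → IsWalk A m a e (line a c m)) (line-reaches a b m r rM≡1)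
                              (line-isWalk c (eval-shrink r ⟪ m ⟫ (a -ᵥ b) rM≡1 q≡M²) m a)
        E≡0 : energy c a b m ≡ 0ℚ
        E≡0 = energy-straight a b m r rM≡1 q≡M²

mainTheorem11 : (n : ℕ) (A : QForm n) → PositiveDefinite A →
    (a b : Point n) → InG0 A a → InG0 A b →
    (k : ℕ) → 1 ≤ k →
    ExactlyOnePath A k a b ⇔ (eval A (a -ᵥ b) ≡ (+ k / 1) * (+ k / 1))
mainTheorem11 n A pd a b a∈G₀ _ (suc k) _ =
  subst (λ K → ExactlyOnePath A (suc k) a b ⇔ (eval A (a -ᵥ b) ≡ K * K)) (⟪⟫≡/1 (suc k))
        (mk⇔ (exactlyOnePath⇒eval≡² A)
             (eval≡²⇒exactlyOnePath A pd a∈G₀ (⟪suc⟫-invertible k)))
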